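{- Let $T$ be a tree and let $G$ be a $T$-graph with a $T$-representation $\{T'_v\}_{v\in V(G)}$ on a subdivision $T'$ of $T$. Then this representation can be modified (keeping a representation of $G$ by subtrees of $T'$) so that for every branching point $b$ of $T$ there is a maximal clique $C$ of $G$ with $b\in\bigcap_{v\in C}V(T'_v)$.
   Context: A subdivision $T'$ of a tree $T$ is obtained by replacing edges of $T$ by paths; the nodes of $T$ are nodes of $T'$. A graph $G$ is a $T$-graph if there is a subdivision $T'$ of $T$ and subtrees $T'_v$ ($v\in V(G)$) of $T'$ such that $uv\in E(G)$ iff $T'_u$ and $T'_v$ share a node; such a family is a $T$-representation. A branching point of $T$ is a node of $T$ of degree at least $3$. -}

module Defs where

open import Data.Nat using (ℕ; zero; suc; _<_; _≤_)
open import Data.Fin using (Fin; toℕ; inject₁; fromℕ) renaming (zero to fzero; suc to fsuc)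
open import Data.Bool using (Bool; true; false; if_then_else_)
open import Data.List using (List; map; allFin)
open import Data.Nat.ListAction using (sum)
open import Data.Product using (Σ; ∃; _×_; _,_)
open import Data.Sum using (_⊎_)
open import Data.Empty using (⊥)
open import Relation.Nullary using (¬_)
open import Relation.Binary.PropositionalEquality using (_≡_; _≢_)

record Graph (n : ℕ) : Set where
  field
    adj    : Fin n → Fin n → Bool
    sym    : ∀ u v → adj u v ≡ adj v u
    irrefl : ∀ u → adj u u ≡ false
open Graph public

Adj : ∀ {n} → Graph n → Fin n → Fin n → Set
Adj G u v = adj G u v ≡ true

Subset : ℕ → Set
Subset n = Fin n → Bool

_∈ₛ_ : ∀ {n} → Fin n → Subset n → Set
x ∈ₛ S = S x ≡ true

data WalkIn {n : ℕ} (G : Graph n) (S : Subset n) : Fin n → Fin n → Set where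
  here : ∀ {x} → x ∈ₛ S → WalkIn G S x x
  step : ∀ {x y z} → x ∈ₛ S → Adj G x y → WalkIn G S y z → WalkIn G S x z

ConnectedOn : ∀ {n} → Graph n → Subset n → Set
ConnectedOn {n} G S = ∀ (x y : Fin n) → x ∈ₛ S → y ∈ₛ S → WalkIn G S x y

everything : ∀ {n} → Subset n
everything _ = true

Injective : ∀ {a b} {A : Set a} {B : Set b} → (A → B) → Set _
Injective f = ∀ x y → f x ≡ f y → x ≡ y

HasCycle : ∀ {n} → Graph n → Set
HasCycle {n} G =
  Σ ℕ λ k → Σ (Fin (suc (suc (suc k))) → Fin n) λ c →
    Injective c
    × (∀ (i : Fin (suc (suc k))) → Adj G (c (inject₁ i)) (c (fsuc i)))
    × Adj G (c (fromℕ (suc (suc k)))) (c fzero)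

IsTree : ∀ {n} → Graph n → Set
IsTree G = ConnectedOn G everything × ¬ HasCycle G

deg : ∀ {n} → Graph n → Fin n → ℕ
deg {n} G v = sum (map (λ u → if adj G v u then 1 else 0) (allFin n))

IsBranching : ∀ {n} → Graph n → Fin n → Set
IsBranching G b = 3 ≤ deg G b

IsSubtree : ∀ {n} → Graph n → Subset n → Set
IsSubtree {n} T' S = (∃ λ x → x ∈ₛ S) × ConnectedOn T' S

-- T' is a subdivision of T via an injective embedding ι of
-- nodes, where every edge uv of T (listed once, with u < v) is replaced by a
-- path  P_uv : ι u = p₀, p₁, …, p_len = ι v  in T', such that:
--  * P_uv meets ι(V(T)) only in ι u, ι v,
--  * distinct paths share only nodes of T,
--  * every edge of T' is an edge of some P_uv, and
--  * every vertex of T' is a node of T or lies on some P_uv.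

record Subdivision {m m' : ℕ} (T : Graph m) (T' : Graph m') : Set where
  field
    ι      : Fin m → Fin m'
    ι-inj  : Injective ι
    len    : ∀ (u v : Fin m) → toℕ u < toℕ v → Adj T u v → ℕ
    path   : ∀ u v (o : toℕ u < toℕ v) (e : Adj T u v) → Fin (suc (len u v o e)) → Fin m'
    path-start : ∀ u v o e → path u v o e fzero ≡ ι u
    path-end   : ∀ u v o e → path u v o e (fromℕ (len u v o e)) ≡ ι v
    path-inj   : ∀ u v o e → Injective (path u v o e)
    path-adj   : ∀ u v o e (i : Fin (len u v o e)) →
                 Adj T' (path u v o e (inject₁ i)) (path u v o e (fsuc i))
    path-nodes : ∀ u v o e i a → path u v o e i ≡ ι a → (a ≡ u) ⊎ (a ≡ v)
    path-disj  : ∀ u v o e i u' v' o' e' j →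
                 path u v o e i ≡ path u' v' o' e' j →
                 ¬ (u ≡ u' × v ≡ v') → ∃ λ a → ι a ≡ path u v o e i
    edge-cover : ∀ x y → Adj T' x y →
                 Σ (Fin m) λ u → Σ (Fin m) λ v → Σ (toℕ u < toℕ v) λ o → Σ (Adj T u v) λ e →
                 Σ (Fin (len u v o e)) λ i →
                   (x ≡ path u v o e (inject₁ i) × y ≡ path u v o e (fsuc i))
                   ⊎ (y ≡ path u v o e (inject₁ i) × x ≡ path u v o e (fsuc i))
    vertex-cover : ∀ x → (∃ λ a → ι a ≡ x)
                   ⊎ (Σ (Fin m) λ u → Σ (Fin m) λ v → Σ (toℕ u < toℕ v) λ o → Σ (Adj T u v) λ e →
                      Σ (Fin (suc (len u v o e))) λ i → path u v o e i ≡ x)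
open Subdivision public

record Representation {n m' : ℕ} (G : Graph n) (T' : Graph m') : Set where
  field
    sub      : Fin n → Subset m'
    subtree  : ∀ v → IsSubtree T' (sub v)
    correct  : ∀ u v → u ≢ v →
               (Adj G u v → ∃ λ x → x ∈ₛ sub u × x ∈ₛ sub v)
               × ((∃ λ x → x ∈ₛ sub u × x ∈ₛ sub v) → Adj G u v)
open Representation public

IsClique : ∀ {n} → Graph n → Subset n → Set
IsClique G C = ∀ u v → u ∈ₛ C → v ∈ₛ C → u ≢ v → Adj G u v

IsMaximalClique : ∀ {n} → Graph n → Subset n → Set
IsMaximalClique {n} G C =
  IsClique G C × (∀ C' → IsClique G C' → (∀ x → x ∈ₛ C → x ∈ₛ C') → ∀ x → x ∈ₛ C' → x ∈ₛ C)

-- Call a representation stable if, for every edge ab of T′, whenever every subtree through a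
-- also contains b, every subtree through b contains a. An unstable edge is repaired by adding a
-- to every subtree through b: this is again a representation of G and strictly enlarges the
-- finite incidence relation, so repeated repairs terminate. In a stable representation the set
-- C_z of subtrees through any node z of T′ is a maximal clique: given a clique C ⊇ C_z and w ∈ C,
-- follow a simple path from z towards T′_w. At a step xy with x ∉ T′_w, a subtree through x but
-- not y would combine with T′_w into a walk from x to y avoiding the edge xy, impossible since
-- every edge of the subdivided tree T′ is a bridge; so C_x ⊆ C_y, stability gives C_y ⊆ C_x, and
-- induction along the path puts z in T′_w. This holds at every node of T′.

module Submission where

open import Level using (0ℓ)
open import Defs hiding (sym)
open import Data.Nat using (ℕ; zero; suc; _+_; _*_; _≤_; _<_; z≤n)
import Data.Nat.Properties as ℕ
open import Data.Fin using (Fin; toℕ; inject₁; fromℕ; _≟_; remQuot; combine) renaming (zero to fzero; suc to fsuc)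
import Data.Fin.Properties as Fin
import Data.Fin.Subset as FinSubset
import Data.Fin.Subset.Properties as FinSubset
open import Data.Bool using (Bool; true; false; _∨_; _∧_)
import Data.Bool as Bool
open import Data.Vec using (tabulate)
open import Data.Vec.Properties using (lookup∘tabulate; lookup⇒[]=; []=⇒lookup)
open import Data.Product using (Σ; ∃; _×_; _,_; proj₁; proj₂; uncurry)
open import Data.Sum using (_⊎_; inj₁; inj₂)
open import Data.Empty using (⊥; ⊥-elim)
open import Relation.Nullary using (¬_; Dec; yes; no; does)
open import Relation.Nullary.Decidable using (_×-dec_; _→-dec_; dec-true)
open import Relation.Binary.Core using (Rel)
open import Relation.Binary.Definitions using (DecidableEquality; tri<; tri≈; tri>)
open import Relation.Binary.PropositionalEquality using (_≡_; _≢_; refl; sym; trans; cong; subst)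
open import Relation.Binary.Construct.Closure.ReflexiveTransitive using (Star; ε; _◅_; _◅◅_; reverse) renaming (map to map⋆)
open import Axiom.UniquenessOfIdentityProofs using (module Decidable⇒UIP)

private
  variable
    k : ℕ

_⊆ₛ_ : Subset k → Subset k → Set
S ⊆ₛ S' = ∀ x → x ∈ₛ S → x ∈ₛ S'

Walk : Graph k → Rel (Fin k) 0ℓ
Walk G = Star (Adj G)

adj-sym : (G : Graph k) {a b : Fin k} → Adj G a b → Adj G b a
adj-sym G {a} {b} e = trans (Graph.sym G b a) e

VertexAvoiding : Graph k → Fin k → Rel (Fin k) 0ℓ
VertexAvoiding G x a b = Adj G a b × a ≢ x × b ≢ x

vertexAvoiding-sym : (G : Graph k) {x a b : Fin k} → VertexAvoiding G x a b → VertexAvoiding G x b a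
vertexAvoiding-sym G (e , a≢x , b≢x) = adj-sym G e , b≢x , a≢x

SameEdge : {A : Set} → A → A → A → A → Set
SameEdge x y a b = (a ≡ x × b ≡ y) ⊎ (a ≡ y × b ≡ x)

EdgeAvoiding : Graph k → Fin k → Fin k → Rel (Fin k) 0ℓ
EdgeAvoiding G x y a b = Adj G a b × ¬ SameEdge x y a b

IsBridge : Graph k → Fin k → Fin k → Set
IsBridge G x y = ¬ Star (EdgeAvoiding G x y) x y

sameEdge-flip : {A : Set} {x y a b : A} → SameEdge x y a b → SameEdge y x b a
sameEdge-flip (inj₁ (p , q)) = inj₁ (q , p)
sameEdge-flip (inj₂ (p , q)) = inj₂ (q , p)

sameEdge-swap : {A : Set} {x y a b : A} → SameEdge x y a b → SameEdge x y b a
sameEdge-swap (inj₁ (p , q)) = inj₂ (q , p)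
sameEdge-swap (inj₂ (p , q)) = inj₁ (q , p)

edgeAvoiding-flip : (G : Graph k) {x y a b : Fin k} → EdgeAvoiding G x y a b → EdgeAvoiding G y x b a
edgeAvoiding-flip G (e , ne) = adj-sym G e , λ s → ne (sameEdge-flip s)

isBridge-sym : (G : Graph k) {x y : Fin k} → IsBridge G x y → IsBridge G y x
isBridge-sym G nb w = nb (reverse (edgeAvoiding-flip G) w)

avoidsˡ : (G : Graph k) {x y a b : Fin k} → VertexAvoiding G x a b → EdgeAvoiding G x y a b
avoidsˡ G (e , ax , bx) = e , λ { (inj₁ (p , _)) → ax p ; (inj₂ (_ , q)) → bx q }

avoidsʳ : (G : Graph k) {x y a b : Fin k} → VertexAvoiding G y a b → EdgeAvoiding G x y a b
avoidsʳ G (e , ay , by) = e , λ { (inj₁ (_ , q)) → by q ; (inj₂ (p , _)) → ay p }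

true-and-false : {b : Bool} → b ≡ true → b ≡ false → ⊥
true-and-false refl ()

walkIn-head : {G : Graph k} {S : Subset k} {x y : Fin k} → WalkIn G S x y → x ∈ₛ S
walkIn-head (here p) = p
walkIn-head (step p _ _) = p

walkIn-++ : {G : Graph k} {S : Subset k} {x y z : Fin k} → WalkIn G S x y → WalkIn G S y z → WalkIn G S x z
walkIn-++ (here _) w' = w'
walkIn-++ (step p e w) w' = step p e (walkIn-++ w w')

walkIn-mono : {G : Graph k} {S S' : Subset k} → S ⊆ₛ S' →
              {x y : Fin k} → WalkIn G S x y → WalkIn G S' x y
walkIn-mono h (here p) = here (h _ p)
walkIn-mono h (step p e w) = step (h _ p) e (walkIn-mono h w)

walkIn-avoiding : {G : Graph k} {S : Subset k} {x y z : Fin k} → S z ≡ false →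
                  WalkIn G S x y → Star (VertexAvoiding G z) x y
walkIn-avoiding z∉S (here _) = ε
walkIn-avoiding {S = S} {z = z} z∉S (step p e w) =
  (e , outside p , outside (walkIn-head w)) ◅ walkIn-avoiding z∉S w
  where
    outside : ∀ {a} → a ∈ₛ S → a ≢ z
    outside a∈S refl = true-and-false a∈S z∉S

module SimplePaths {A : Set} (_≟ₐ_ : DecidableEquality A) (R : Rel A 0ℓ) where

  infixr 5 _∷_∣_

  mutual
    data SimplePath : A → A → Set where
      []    : ∀ {x} → SimplePath x x
      _∷_∣_ : ∀ {x y z} → R x y → (p : SimplePath y z) → (∀ i → vertex p i ≢ x) → SimplePath x z

    length : ∀ {x z} → SimplePath x z → ℕ
    length [] = 0
    length (_ ∷ p ∣ _) = suc (length p)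

    vertex : ∀ {x z} (p : SimplePath x z) → Fin (suc (length p)) → A
    vertex {x} [] _ = x
    vertex {x} (_ ∷ _ ∣ _) fzero = x
    vertex (_ ∷ p ∣ _) (fsuc i) = vertex p i

  vertex-first : ∀ {x z} (p : SimplePath x z) → vertex p fzero ≡ x
  vertex-first [] = refl
  vertex-first (_ ∷ _ ∣ _) = refl

  vertex-last : ∀ {x z} (p : SimplePath x z) → vertex p (fromℕ (length p)) ≡ z
  vertex-last [] = refl
  vertex-last (_ ∷ p ∣ _) = vertex-last p

  vertex-injective : ∀ {x z} (p : SimplePath x z) → Injective (vertex p)
  vertex-injective [] fzero fzero _ = refl
  vertex-injective (_ ∷ _ ∣ _) fzero fzero _ = refl
  vertex-injective (_ ∷ _ ∣ x∉p) fzero (fsuc j) eq = ⊥-elim (x∉p j (sym eq))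
  vertex-injective (_ ∷ _ ∣ x∉p) (fsuc i) fzero eq = ⊥-elim (x∉p i eq)
  vertex-injective (_ ∷ p ∣ _) (fsuc i) (fsuc j) eq = cong fsuc (vertex-injective p i j eq)

  vertex-step : ∀ {x z} (p : SimplePath x z) (i : Fin (length p)) → R (vertex p (inject₁ i)) (vertex p (fsuc i))
  vertex-step (r ∷ p ∣ _) fzero = subst (R _) (sym (vertex-first p)) r
  vertex-step (_ ∷ p ∣ _) (fsuc i) = vertex-step p i

  suffix : ∀ {x z} (p : SimplePath x z) (i : Fin (suc (length p))) → SimplePath (vertex p i) z
  suffix [] fzero = []
  suffix p@(_ ∷ _ ∣ _) fzero = p
  suffix (_ ∷ p ∣ _) (fsuc i) = suffix p i

  erase : ∀ {x z} → Star R x z → SimplePath x z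
  erase ε = []
  erase {x} {z} (r ◅ w) with erase w
  ... | p with Fin.any? (λ i → vertex p i ≟ₐ x)
  ... | yes (i , pᵢ≡x) = subst (λ t → SimplePath t z) pᵢ≡x (suffix p i)
  ... | no x∉p = r ∷ p ∣ λ i pᵢ≡x → x∉p (i , pᵢ≡x)

  avoiding : ∀ {x z a} (p : SimplePath x z) → (∀ i → vertex p i ≢ a) →
             Star (λ b c → R b c × b ≢ a × c ≢ a) x z
  avoiding [] a∉p = ε
  avoiding (r ∷ p ∣ _) a∉p =
    (r , a∉p fzero , subst (_≢ _) (vertex-first p) (a∉p (fsuc fzero))) ◅ avoiding p (λ i → a∉p (fsuc i))

acyclic⇒bridge : (G : Graph k) → ¬ HasCycle G → ∀ {u v} → Adj G u v → IsBridge G u v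
acyclic⇒bridge G acyclic {u} {v} uv w = closes (erase w)
  where
    open SimplePaths _≟_ (EdgeAvoiding G u v)
    closes : SimplePath u v → ⊥
    closes [] = true-and-false uv (Graph.irrefl G u)
    closes ((_ , ¬uv) ∷ [] ∣ _) = ¬uv (inj₁ (refl , refl))
    closes p@(_ ∷ (_ ∷ q ∣ _) ∣ _) =
      acyclic (length q , vertex p , vertex-injective p , (λ i → proj₁ (vertex-step p i)) , closing)
      where
        closing : Adj G (vertex p (fromℕ (suc (suc (length q))))) u
        closing = subst (λ t → Adj G t u) (sym (vertex-last p)) (adj-sym G uv)

pathWalk : (G : Graph k) (L : ℕ) (f : Fin (suc L) → Fin k) →
           (∀ (i : Fin L) → Adj G (f (inject₁ i)) (f (fsuc i))) → ∀ j → Walk G (f fzero) (f j)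
pathWalk G L f _ fzero = ε
pathWalk G (suc L) f steps (fsuc j) = steps fzero ◅ pathWalk G L (λ t → f (fsuc t)) (λ i → steps (fsuc i)) j

module SubdivisionConnected {m m' : ℕ} {T : Graph m} {T' : Graph m'}
                            (connected : ConnectedOn T everything) (sd : Subdivision T T') where

  walkAlong : ∀ u v o e j → Walk T' (ι sd u) (path sd u v o e j)
  walkAlong u v o e j = subst (λ t → Walk T' t (path sd u v o e j)) (path-start sd u v o e)
                          (pathWalk T' (len sd u v o e) (path sd u v o e) (path-adj sd u v o e) j)

  walkOrdered : ∀ a b (o : toℕ a < toℕ b) (e : Adj T a b) → Walk T' (ι sd a) (ι sd b)
  walkOrdered a b o e = subst (Walk T' (ι sd a)) (path-end sd a b o e) (walkAlong a b o e (fromℕ _))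

  walkEdge : ∀ a b → Adj T a b → Walk T' (ι sd a) (ι sd b)
  walkEdge a b e with ℕ.<-cmp (toℕ a) (toℕ b)
  ... | tri< a<b _ _ = walkOrdered a b a<b e
  ... | tri> _ _ b<a = reverse (adj-sym T') (walkOrdered b a b<a (adj-sym T e))
  ... | tri≈ _ a≡b _ with Fin.toℕ-injective a≡b
  ... | refl = ⊥-elim (true-and-false e (Graph.irrefl T a))

  liftWalk : ∀ {S a b} → WalkIn T S a b → Walk T' (ι sd a) (ι sd b)
  liftWalk (here _) = ε
  liftWalk (step _ e w) = walkEdge _ _ e ◅◅ liftWalk w

  walkFromNode : ∀ z → Σ (Fin m) λ a → Walk T' (ι sd a) z
  walkFromNode z with vertex-cover sd z
  ... | inj₁ (a , refl) = a , ε
  ... | inj₂ (u , v , o , e , j , refl) = u , walkAlong u v o e j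

  subdivision-connected : ∀ z z' → Walk T' z z'
  subdivision-connected z z' with walkFromNode z | walkFromNode z'
  ... | a , w | a' , w' = reverse (adj-sym T') w ◅◅ liftWalk (connected a a' refl refl) ◅◅ w'

Bool-UIP : {a b : Bool} (p q : a ≡ b) → p ≡ q
Bool-UIP = Decidable⇒UIP.≡-irrelevant Bool._≟_

edgeIndices : {A : Set} {L : ℕ} {a b : A} (f : Fin (suc L) → A) (k : Fin L) →
              (a ≡ f (inject₁ k) × b ≡ f (fsuc k)) ⊎ (b ≡ f (inject₁ k) × a ≡ f (fsuc k)) →
              Σ (Fin (suc L)) λ ja → Σ (Fin (suc L)) λ jb → f ja ≡ a × f jb ≡ b
edgeIndices f k (inj₁ (a≡ , b≡)) = inject₁ k , fsuc k , sym a≡ , sym b≡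
edgeIndices f k (inj₂ (b≡ , a≡)) = fsuc k , inject₁ k , sym a≡ , sym b≡

module SubdivisionBridges {m m' : ℕ} {T : Graph m} {T' : Graph m'}
                          (acyclic : ¬ HasCycle T) (sd : Subdivision T T') where

  otherEdge-avoids : ∀ {u v u' v' : Fin m} → toℕ u < toℕ v → toℕ u' < toℕ v' →
                     ¬ (u ≡ u' × v ≡ v') → ¬ SameEdge u v u' v'
  otherEdge-avoids u<v u'<v' ne (inj₁ (refl , refl)) = ne (refl , refl)
  otherEdge-avoids u<v u'<v' ne (inj₂ (refl , refl)) = ℕ.<-asym u<v u'<v'

  module PathEdge (u v : Fin m) (o : toℕ u < toℕ v) (e : Adj T u v) (i : Fin (len sd u v o e)) where

    P : Fin (suc (len sd u v o e)) → Fin m'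
    P = path sd u v o e

    x y : Fin m'
    x = P (inject₁ i)
    y = P (fsuc i)

    Reach : Fin m → Set
    Reach = Star (EdgeAvoiding T u v) u

    reach-forward : ∀ {u' v'} (o' : toℕ u' < toℕ v') → Adj T u' v' → ¬ (u ≡ u' × v ≡ v') →
                    Reach u' → ∀ c → c ≡ u' ⊎ c ≡ v' → Reach c
    reach-forward o' e' ne r c (inj₁ refl) = r
    reach-forward o' e' ne r c (inj₂ refl) = r ◅◅ ((e' , otherEdge-avoids o o' ne) ◅ ε)

    reach-back : ∀ {u' v'} (o' : toℕ u' < toℕ v') → Adj T u' v' → ¬ (u ≡ u' × v ≡ v') →
                 ∀ c → c ≡ u' ⊎ c ≡ v' → Reach c → Reach u'
    reach-back o' e' ne c (inj₁ refl) r = r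
    reach-back o' e' ne c (inj₂ refl) r =
      r ◅◅ ((adj-sym T e' , λ s → otherEdge-avoids o o' ne (sameEdge-swap s)) ◅ ε)

    -- The component of ι u in T′ minus the edge xy, described through T minus uv. It contains x,
    -- is closed under the remaining edges, and does not contain y.
    data USide (z : Fin m') : Set where
      node   : ∀ a → ι sd a ≡ z → Reach a → USide z
      other  : ∀ u' v' o' e' j → path sd u' v' o' e' j ≡ z → ¬ (u ≡ u' × v ≡ v') → Reach u' → USide z
      before : ∀ j → P j ≡ z → toℕ j ≤ toℕ i → USide z

    before-not-end : ∀ j → toℕ j ≤ toℕ i → P j ≢ ι sd v
    before-not-end j j≤i Pj≡v with path-inj sd u v o e j (fromℕ _) (trans Pj≡v (sym (path-end sd u v o e)))
    ... | refl = ℕ.<⇒≱ (Fin.toℕ<n i) (subst (_≤ toℕ i) (Fin.toℕ-fromℕ _) j≤i)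

    uSide-reachable : ∀ {z} → USide z → ∀ c → ι sd c ≡ z → Reach c
    uSide-reachable (node a a≡z r) c c≡z = subst Reach (ι-inj sd a c (trans a≡z (sym c≡z))) r
    uSide-reachable (other u' v' o' e' j eq ne r) c c≡z =
      reach-forward o' e' ne r c (path-nodes sd u' v' o' e' j c (trans eq (sym c≡z)))
    uSide-reachable (before j eq j≤i) c c≡z with path-nodes sd u v o e j c (trans eq (sym c≡z))
    ... | inj₁ refl = ε
    ... | inj₂ refl = ⊥-elim (before-not-end j j≤i (trans eq (sym c≡z)))

    otherStart-viaNode : ∀ {z} → USide z → ∀ a → ι sd a ≡ z → ∀ u' v' o' e' j → path sd u' v' o' e' j ≡ z →
              ¬ (u ≡ u' × v ≡ v') → Reach u'
    otherStart-viaNode s a a≡z u' v' o' e' j eq ne =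
      reach-back o' e' ne a (path-nodes sd u' v' o' e' j a (trans eq (sym a≡z))) (uSide-reachable s a a≡z)

    uSide-otherStart : ∀ {z} → USide z → ∀ u' v' o' e' j → path sd u' v' o' e' j ≡ z →
                  ¬ (u ≡ u' × v ≡ v') → Reach u'
    uSide-otherStart s@(node a a≡z _) = otherStart-viaNode s a a≡z
    uSide-otherStart s@(other u'' v'' o'' e'' j'' eq'' _ r) u' v' o' e' j eq ne
      with (u'' ≟ u') ×-dec (v'' ≟ v')
    ... | yes (refl , refl) = r
    ... | no ne'' = let (a , a≡z) = path-disj sd u'' v'' o'' e'' j'' u' v' o' e' j (trans eq'' (sym eq)) ne''
                    in otherStart-viaNode s a (trans a≡z eq'') u' v' o' e' j eq ne
    uSide-otherStart s@(before j'' eq'' _) u' v' o' e' j eq ne =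
      let (a , a≡z) = path-disj sd u v o e j'' u' v' o' e' j (trans eq'' (sym eq)) ne
      in otherStart-viaNode s a (trans a≡z eq'') u' v' o' e' j eq ne

    reachableNode-onPath : ∀ {z} a → ι sd a ≡ z → Reach a → ∀ j → P j ≡ z → toℕ j ≤ toℕ i
    reachableNode-onPath a a≡z r j eq with path-nodes sd u v o e j a (trans eq (sym a≡z))
    ... | inj₂ refl = ⊥-elim (acyclic⇒bridge T acyclic e r)
    ... | inj₁ refl with path-inj sd u v o e j fzero (trans (trans eq (sym a≡z)) (sym (path-start sd u v o e)))
    ... | refl = z≤n

    uSide-onPath : ∀ {z} → USide z → ∀ j → P j ≡ z → toℕ j ≤ toℕ i
    uSide-onPath (node a a≡z r) = reachableNode-onPath a a≡z r
    uSide-onPath (before j'' eq'' j''≤i) j eq with path-inj sd u v o e j'' j (trans eq'' (sym eq))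
    ... | refl = j''≤i
    uSide-onPath s@(other u' v' o' e' j' eq' ne _) j eq =
      let (a , a≡z) = path-disj sd u' v' o' e' j' u v o e j (trans eq' (sym eq)) λ (p , q) → ne (sym p , sym q)
      in reachableNode-onPath a (trans a≡z eq') (uSide-reachable s a (trans a≡z eq')) j eq

    alongPath : ∀ {a b} → USide a → (k : Fin (len sd u v o e)) →
                (a ≡ P (inject₁ k) × b ≡ P (fsuc k)) ⊎ (b ≡ P (inject₁ k) × a ≡ P (fsuc k)) →
                ¬ SameEdge x y a b → USide b
    alongPath s k (inj₁ (refl , refl)) ¬xy with k ≟ i
    ... | yes refl = ⊥-elim (¬xy (inj₁ (refl , refl)))
    ... | no k≢i = before (fsuc k) refl (ℕ.≤∧≢⇒< k≤i (λ q → k≢i (Fin.toℕ-injective q)))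
      where
        k≤i : toℕ k ≤ toℕ i
        k≤i = subst (_≤ toℕ i) (Fin.toℕ-inject₁ k) (uSide-onPath s (inject₁ k) refl)
    alongPath s k (inj₂ (refl , refl)) _ =
      before (inject₁ k) refl (subst (_≤ toℕ i) (sym (Fin.toℕ-inject₁ k)) (ℕ.<⇒≤ (uSide-onPath s (fsuc k) refl)))

    uSide-step : ∀ {a b} → USide a → EdgeAvoiding T' x y a b → USide b
    uSide-step {a} {b} s (ab , ¬xy) with edge-cover sd a b ab
    ... | u' , v' , o' , e' , k , dir with (u ≟ u') ×-dec (v ≟ v')
    ... | no ne = let (ja , jb , eqa , eqb) = edgeIndices (path sd u' v' o' e') k dir
                  in other u' v' o' e' jb eqb ne (uSide-otherStart s u' v' o' e' ja eqa ne)
    ... | yes (refl , refl) with ℕ.<-irrelevant o o' | Bool-UIP e e'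
    ... | refl | refl = alongPath s k dir ¬xy

    uSide-walk : ∀ {a b} → USide a → Star (EdgeAvoiding T' x y) a b → USide b
    uSide-walk s ε = s
    uSide-walk s (r ◅ w) = uSide-walk (uSide-step s r) w

    pathEdge-bridge : IsBridge T' x y
    pathEdge-bridge w = ℕ.n≮n (toℕ i) (uSide-onPath (uSide-walk x-side w) (fsuc i) refl)
      where
        x-side : USide x
        x-side = before (inject₁ i) refl (ℕ.≤-reflexive (Fin.toℕ-inject₁ i))

  subdivision-bridge : ∀ {x y} → Adj T' x y → IsBridge T' x y
  subdivision-bridge xy with edge-cover sd _ _ xy
  ... | u , v , o , e , i , inj₁ (refl , refl) = PathEdge.pathEdge-bridge u v o e i
  ... | u , v , o , e , i , inj₂ (refl , refl) = isBridge-sym T' (PathEdge.pathEdge-bridge u v o e i)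

module Representations {n m' : ℕ} (G : Graph n) (T' : Graph m') where

  Rep : Set
  Rep = Representation G T'

  cliqueAt : Rep → Fin m' → Subset n
  cliqueAt R z v = sub R v z

  Stable : Rep → Set
  Stable R = ∀ a b → Adj T' a b → cliqueAt R a ⊆ₛ cliqueAt R b → cliqueAt R b ⊆ₛ cliqueAt R a

  split : Fin (n * m') → Fin n × Fin m'
  split = remQuot {n} m'

  -- The pairs (v , z) with z ∈ T′ᵥ, encoded in Fin (n * m′).
  incidence : Rep → FinSubset.Subset (n * m')
  incidence R = tabulate (λ p → uncurry (sub R) (split p))

  size : Rep → ℕ
  size R = FinSubset.∣ incidence R ∣

  ∈-incidence⁺ : ∀ (R : Rep) p → uncurry (sub R) (split p) ≡ true → p FinSubset.∈ incidence R
  ∈-incidence⁺ R p p∈ = lookup⇒[]= p (incidence R) (trans (lookup∘tabulate _ p) p∈)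

  ∈-incidence⁻ : ∀ (R : Rep) p → p FinSubset.∈ incidence R → uncurry (sub R) (split p) ≡ true
  ∈-incidence⁻ R p p∈ = trans (sym (lookup∘tabulate _ p)) ([]=⇒lookup p∈)

  incidence-combine : ∀ (R : Rep) v z → uncurry (sub R) (split (combine v z)) ≡ sub R v z
  incidence-combine R v z = cong (uncurry (sub R)) (Fin.remQuot-combine v z)

  incidence-mono : ∀ R R' → (∀ v → sub R v ⊆ₛ sub R' v) → incidence R FinSubset.⊆ incidence R'
  incidence-mono R R' R⊆R' {p} p∈ =
    ∈-incidence⁺ R' p (R⊆R' (proj₁ (split p)) (proj₂ (split p)) (∈-incidence⁻ R p p∈))

  module Repair (R : Rep) {a b : Fin m'} (ab : Adj T' a b) (a⊆b : cliqueAt R a ⊆ₛ cliqueAt R b) where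

    sub' : Fin n → Subset m'
    sub' v z = sub R v z ∨ (does (z ≟ a) ∧ sub R v b)

    sub⊆sub' : ∀ v → sub R v ⊆ₛ sub' v
    sub⊆sub' v z z∈v rewrite z∈v = refl

    a∈sub' : ∀ v → b ∈ₛ sub R v → a ∈ₛ sub' v
    a∈sub' v b∈v with sub R v a
    ... | true = refl
    ... | false rewrite dec-true (a ≟ a) refl = b∈v

    sub'-cases : ∀ v z → z ∈ₛ sub' v → z ∈ₛ sub R v ⊎ (z ≡ a × b ∈ₛ sub R v)
    sub'-cases v z z∈v' with sub R v z
    ... | true = inj₁ refl
    ... | false with z ≟ a
    ... | yes z≡a = inj₂ (z≡a , z∈v')
    ... | no _ = ⊥-elim (true-and-false z∈v' refl)

    b∈sub : ∀ v → a ∈ₛ sub' v → b ∈ₛ sub R v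
    b∈sub v a∈v' with sub'-cases v a a∈v'
    ... | inj₁ a∈v = a⊆b v a∈v
    ... | inj₂ (_ , b∈v) = b∈v

    walkInSub : ∀ v x y → x ∈ₛ sub R v → y ∈ₛ sub R v → WalkIn T' (sub' v) x y
    walkInSub v x y x∈v y∈v = walkIn-mono (sub⊆sub' v) (proj₂ (subtree R v) x y x∈v y∈v)

    sub'-connected : ∀ v → ConnectedOn T' (sub' v)
    sub'-connected v x y x∈ y∈ with sub'-cases v x x∈ | sub'-cases v y y∈
    ... | inj₁ x∈v | inj₁ y∈v = walkInSub v x y x∈v y∈v
    ... | inj₂ (refl , b∈v) | inj₁ y∈v = step x∈ ab (walkInSub v b y b∈v y∈v)
    ... | inj₂ (refl , _) | inj₂ (refl , _) = here x∈
    ... | inj₁ x∈v | inj₂ (refl , b∈v) =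
      walkIn-++ (walkInSub v x b x∈v b∈v) (step (sub⊆sub' v b b∈v) (adj-sym T' ab) (here y∈))

    repair : Rep
    repair = record
      { sub = sub'
      ; subtree = λ v → let (z , z∈v) = proj₁ (subtree R v) in (z , sub⊆sub' v z z∈v) , sub'-connected v
      ; correct = λ u w u≢w →
          (λ uw → let (z , z∈u , z∈w) = proj₁ (correct R u w u≢w) uw in z , sub⊆sub' u z z∈u , sub⊆sub' w z z∈w)
          , λ (z , z∈u , z∈w) → proj₂ (correct R u w u≢w) (meet z z∈u z∈w)
      }
      where
        -- The repaired subtrees meet only where the old ones did: at a, both already contained b.
        meet : ∀ {u w} z → z ∈ₛ sub' u → z ∈ₛ sub' w → ∃ λ y → y ∈ₛ sub R u × y ∈ₛ sub R w
        meet {u} {w} z z∈u z∈w with sub'-cases u z z∈u | sub'-cases w z z∈w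
        ... | inj₁ z∈ᵤ | inj₁ z∈w = z , z∈ᵤ , z∈w
        ... | inj₂ (refl , b∈u) | _ = b , b∈u , b∈sub w z∈w
        ... | inj₁ _ | inj₂ (refl , b∈w) = b , b∈sub u z∈u , b∈w

    size-repair : ∀ v → b ∈ₛ sub R v → sub R v a ≡ false → size R < size repair
    size-repair v b∈v a∉v = FinSubset.p⊂q⇒∣p∣<∣q∣ (incidence-mono R repair sub⊆sub' , combine v a , new∈ , new∉)
      where
        new∈ : combine v a FinSubset.∈ incidence repair
        new∈ = ∈-incidence⁺ repair _ (trans (incidence-combine repair v a) (a∈sub' v b∈v))
        new∉ : combine v a FinSubset.∉ incidence R
        new∉ p∈ = true-and-false (trans (sym (incidence-combine R v a)) (∈-incidence⁻ R _ p∈)) a∉v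

  Unstable : Rep → Set
  Unstable R = Σ (Fin m') λ a → Σ (Fin m') λ b → Adj T' a b × cliqueAt R a ⊆ₛ cliqueAt R b
               × Σ (Fin n) λ v → b ∈ₛ sub R v × sub R v a ≡ false

  unstable? : ∀ R → Dec (Unstable R)
  unstable? R = Fin.any? λ a → Fin.any? λ b →
    (adj T' a b Bool.≟ true) ×-dec ⊆? a b
    ×-dec Fin.any? (λ v → (sub R v b Bool.≟ true) ×-dec (sub R v a Bool.≟ false))
    where
      ⊆? : ∀ a b → Dec (cliqueAt R a ⊆ₛ cliqueAt R b)
      ⊆? a b = Fin.all? λ v → (sub R v a Bool.≟ true) →-dec (sub R v b Bool.≟ true)

  ¬unstable⇒stable : ∀ R → ¬ Unstable R → Stable R
  ¬unstable⇒stable R ¬unstable a b ab a⊆b v b∈v with sub R v a in a∈v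
  ... | true = refl
  ... | false = ⊥-elim (¬unstable (a , b , ab , a⊆b , v , b∈v , a∈v))

  stabilise-within : ∀ fuel R → n * m' ≤ size R + fuel → Σ Rep Stable
  stabilise-within fuel R bound with unstable? R
  ... | no ¬unstable = R , ¬unstable⇒stable R ¬unstable
  ... | yes (a , b , ab , a⊆b , v , b∈v , a∉v) with Repair.size-repair R ab a⊆b v b∈v a∉v
  stabilise-within zero R bound | yes (a , b , ab , a⊆b , _) | grows =
    ⊥-elim (ℕ.<⇒≱ grows (ℕ.≤-trans (FinSubset.∣p∣≤n (incidence (Repair.repair R ab a⊆b)))
                                    (subst (n * m' ≤_) (ℕ.+-identityʳ _) bound)))
  stabilise-within (suc fuel) R bound | yes (a , b , ab , a⊆b , _) | grows =
    stabilise-within fuel (Repair.repair R ab a⊆b)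
      (ℕ.≤-trans bound (ℕ.≤-trans (ℕ.≤-reflexive (ℕ.+-suc _ fuel)) (ℕ.+-monoˡ-≤ fuel grows)))

  stabilise : Rep → Σ Rep Stable
  stabilise R = stabilise-within (n * m') R (ℕ.m≤n+m _ _)

  cliqueAt-isClique : ∀ R z → IsClique G (cliqueAt R z)
  cliqueAt-isClique R z u w u∈ w∈ u≢w = proj₂ (correct R u w u≢w) (z , u∈ , w∈)

  module StableOnTree (connected : ∀ z z' → Walk T' z z') (bridge : ∀ {x y} → Adj T' x y → IsBridge T' x y)
                      (R : Rep) (stable : Stable R) where

    open SimplePaths _≟_ (Adj T')

    reaches : ∀ C → IsClique G C → ∀ {w} → w ∈ₛ C → ∀ {x z} → SimplePath x z → z ∈ₛ sub R w →
              cliqueAt R x ⊆ₛ C → x ∈ₛ sub R w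
    reaches C clique w∈C [] z∈w _ = z∈w
    reaches C clique {w} w∈C {x} {z} (_∷_∣_ {y = y} xy p x∉p) z∈w Cx⊆C with sub R w x in x∉w
    ... | true = refl
    ... | false = trans (sym x∉w) (Cy⊆Cx w (reaches C clique w∈C p z∈w λ v y∈v → Cx⊆C v (Cy⊆Cx v y∈v)))
      where
        Cx⊆Cy : cliqueAt R x ⊆ₛ cliqueAt R y
        Cx⊆Cy v x∈v with sub R v y in y∉v
        ... | true = refl
        ... | false = ⊥-elim (bridge xy detour)
          where
            v≢w : v ≢ w
            v≢w refl = true-and-false x∈v x∉w
            meet : ∃ λ q → q ∈ₛ sub R v × q ∈ₛ sub R w
            meet = proj₁ (correct R v w v≢w) (clique v w (Cx⊆C v x∈v) w∈C v≢w)
            detour : Star (EdgeAvoiding T' x y) x y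
            detour with meet
            ... | q , q∈v , q∈w =
              map⋆ (avoidsʳ T') (walkIn-avoiding y∉v (proj₂ (subtree R v) x q x∈v q∈v))
              ◅◅ map⋆ (avoidsˡ T') (walkIn-avoiding x∉w (proj₂ (subtree R w) q z q∈w z∈w)
                               ◅◅ reverse (vertexAvoiding-sym T') (avoiding p x∉p))
        Cy⊆Cx : cliqueAt R y ⊆ₛ cliqueAt R x
        Cy⊆Cx = stable x y xy Cx⊆Cy

    cliqueAt-maximal : ∀ z → IsMaximalClique G (cliqueAt R z)
    cliqueAt-maximal z = cliqueAt-isClique R z , λ C clique Cz⊆C w w∈C →
      let (q , q∈w) = proj₁ (subtree R w) in reaches C clique w∈C (erase (connected z q)) q∈w Cz⊆C

mainTheorem1 : ∀ {m m' n : ℕ} (T : Graph m) (T' : Graph m') (G : Graph n) →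
    IsTree T → (sd : Subdivision T T') → Representation G T' →
    Σ (Representation G T') λ R →
    ∀ (b : Fin m) → IsBranching T b →
    Σ (Subset n) λ C → IsMaximalClique G C × (∀ v → v ∈ₛ C → ι sd b ∈ₛ sub R v)
mainTheorem1 T T' G (connected , acyclic) sd R₀ with Representations.stabilise G T' R₀
... | R , stable = R , λ b _ → cliqueAt R (ι sd b) , cliqueAt-maximal (ι sd b) , λ v b∈v → b∈v
  where
    open Representations G T'
    open SubdivisionConnected connected sd using (subdivision-connected)
    open SubdivisionBridges acyclic sd using (subdivision-bridge)
    open StableOnTree subdivision-connected subdivision-bridge R stable
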